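{- Let $\mathfrak A$ be a tabular J-algebra or tabular relation algebra with universe $A$, let $i,j<m\in\omega$, $f\in S_m\mathfrak A$, $x,y\in A$, and suppose $\langle i,j\rangle\in\hat f(x;y)$. Then there is $g\in S_{m+1}\mathfrak A$ such that (i) $\langle i,j\rangle\in\hat g(x)\,|\,\hat g(y)$; (ii) $\hat f(z)\subseteq\hat g(z)$ for every $z\in A$; (iii) if $k,\ell<m$, $z\in A$ and $f_k;z\cdot f_\ell=0$, then $g_k;z\cdot g_\ell=0$.
   Context: A J-algebra is an algebra $\langle A,\cdot,0,1,;,{}^{\smile},1'\rangle$ satisfying for all $x,y,z$: $x\cdot(y\cdot z)=(x\cdot y)\cdot z$, $x\cdot y=y\cdot x$, $x\cdot x=x$, $x;(y;z)=(x;y);z$, $x;1'=x$, $(x\cdot y);z=(x\cdot y);z\cdot y;z$, $x^{\smile\smile}=x$, $(x;y)^{\smile}=y^{\smile};x^{\smile}$, $(x\cdot y)^{\smile}=x^{\smile}\cdot y^{\smile}$, $x;y\cdot z=(z;y^{\smile}\cdot x);(y\cdot x^{\smile};z)\cdot z$, $0\cdot x=0$, $x\cdot1=x$, $x;0=0$ (converse binds tightest, then $;$, then $\cdot$). Relation algebras (Tarski) are algebras $\langle A,+,\cdot,-,0,1,;,{}^{\smile},1'\rangle$ whose $\langle\cdot,0,1,;,{}^{\smile},1'\rangle$-reduct is in particular a J-algebra. $x\le y$ means $x\cdot y=x$; $x<y$ means $x\le y\ne x$. $p$ is functional if $p^{\smile};p\le 1'$; $\mathrm{Fn}\,\mathfrak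 A$ is the set of functional elements. $\mathfrak A$ is tabular if for all $v<w$ there are $p,q\in\mathrm{Fn}\,\mathfrak A$ with $0\ne p^{\smile};q\le w$ and $v\cdot p^{\smile};q=0$. For $n\in\omega$, $S_n\mathfrak A$ is the set of sequences $f=\langle f_0,\dots,f_{n-1}\rangle$ such that for all $i,j<n$, $0\ne f_i\in\mathrm{Fn}\,\mathfrak A$ and $f_i;1=f_j;1$; for $f\in S_n\mathfrak A$, $\hat f\colon A\to\wp(n\times n)$ is $\hat f(x)=\{\langle i,j\rangle: i,j<n,\ f_i;x\ge f_j\}$. $|$ denotes composition of binary relations. -}

module Defs where

open import Level using (Level; suc; _⊔_)
open import Data.Nat using (ℕ)
open import Data.Fin using (Fin)
open import Data.Product using (Σ; _×_; ∃)
open import Relation.Binary.PropositionalEquality using (_≡_)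
open import Relation.Nullary using (¬_)

record JAlgebra (a : Level) : Set (suc a) where
  field
    A    : Set a
    _·_  : A → A → A
    𝟘    : A
    𝟙    : A
    _⨾_  : A → A → A
    _˘   : A → A
    1'   : A

  infixl 6 _·_
  infixl 7 _⨾_
  infix  8 _˘
  field

    ·-assoc   : ∀ x y z → x · (y · z) ≡ (x · y) · z
    ·-comm    : ∀ x y → x · y ≡ y · x
    ·-idem    : ∀ x → x · x ≡ x
    ⨾-assoc   : ∀ x y z → x ⨾ (y ⨾ z) ≡ (x ⨾ y) ⨾ z
    ⨾-identʳ  : ∀ x → x ⨾ 1' ≡ x
    ⨾-semidist : ∀ x y z → (x · y) ⨾ z ≡ (x · y) ⨾ z · y ⨾ z
    ˘-invol   : ∀ x → (x ˘) ˘ ≡ x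
    ˘-⨾       : ∀ x y → (x ⨾ y) ˘ ≡ (y ˘) ⨾ (x ˘)
    ˘-·       : ∀ x y → (x · y) ˘ ≡ (x ˘) · (y ˘)
    modular   : ∀ x y z →
                x ⨾ y · z ≡ ((z ⨾ (y ˘) · x) ⨾ (y · (x ˘) ⨾ z)) · z
    𝟘-·       : ∀ x → 𝟘 · x ≡ 𝟘
    𝟙-·       : ∀ x → x · 𝟙 ≡ x
    ⨾-𝟘       : ∀ x → x ⨾ 𝟘 ≡ 𝟘

module _ {a : Level} (𝔄 : JAlgebra a) where
  open JAlgebra 𝔄

  infix 4 _≤_ _<_

  _≤_ : A → A → Set a
  x ≤ y = x · y ≡ x

  _<_ : A → A → Set a
  x < y = x ≤ y × ¬ (y ≡ x)

  Functional : A → Set a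
  Functional p = ((p ˘) ⨾ p) ≤ 1'

  Tabular : Set a
  Tabular = ∀ v w → v < w →
    Σ A λ p → Σ A λ q → Functional p × Functional q ×
      (¬ ((p ˘) ⨾ q ≡ 𝟘)) × ((p ˘) ⨾ q ≤ w) × (v · (p ˘) ⨾ q ≡ 𝟘)

  InS : (n : ℕ) → (Fin n → A) → Set a
  InS n f = (∀ i → ¬ (f i ≡ 𝟘)) × (∀ i → Functional (f i))
          × (∀ i j → f i ⨾ 𝟙 ≡ f j ⨾ 𝟙)

  Hat : {n : ℕ} → (Fin n → A) → A → Fin n → Fin n → Set a
  Hat f x i j = f j ≤ (f i ⨾ x)

  Comp : {n : ℕ} → (Fin n → Fin n → Set a) → (Fin n → Fin n → Set a)
       → Fin n → Fin n → Set a
  Comp R S i j = ∃ λ k → R i k × S k j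

-- Since f_j ≤ f_i;x;y, the modular law makes w = f_j;y˘ · f_i;x nonzero, so tabularity
-- gives functional p, q with 0 ≠ p˘;q ≤ w: read p, q as the two coordinates of new
-- points t with ⟨p t, q t⟩ ∈ w. Restrict to the subidentity δ = 1' · p;(p˘;q;q˘) of
-- those t that really have both coordinates, and let g pull the old f_k back along δ;p
-- and add δ;q as the new last component. Then g_i;x ≥ δ;q because p˘;q ≤ f_i;x, and
-- δ;q;y ≥ g_j because p˘;q ≤ f_j;y˘. Pulling back along the functional element δ;p
-- preserves every containment f_k;z ≥ f_l and every disjointness f_k;z · f_l = 0.

module Submission where

open import Defs hiding (_≤_)
open import Level using (Level)
open import Data.Nat using (ℕ; suc)
open import Data.Fin using (Fin; inject₁; fromℕ)
open import Data.Fin.Relation.Unary.Top using (view; ‵fromℕ; ‵inj₁; view-fromℕ; view-inject₁)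
open import Data.Product using (Σ; _×_; _,_)
open import Relation.Binary.Bundles using (Poset)
open import Relation.Binary.Structures using (IsPartialOrder)
open import Relation.Binary.PropositionalEquality
  using (_≡_; refl; sym; trans; cong; cong₂; subst; subst₂; isEquivalence; module ≡-Reasoning)
open import Relation.Nullary using (¬_)
import Relation.Binary.Reasoning.PartialOrder as PartialOrderReasoning

module FinSnoc {b} {B : Set b} where

  infixl 5 _∷ʳ_

  _∷ʳ_ : ∀ {m} → (Fin m → B) → B → Fin (suc m) → B
  (xs ∷ʳ x) i with view i
  ... | ‵fromℕ = x
  ... | ‵inj₁ {i = k} _ = xs k

  ∷ʳ-inject₁ : ∀ {m} (xs : Fin m → B) x k → (xs ∷ʳ x) (inject₁ k) ≡ xs k
  ∷ʳ-inject₁ xs x k rewrite view-inject₁ k = refl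

  ∷ʳ-last : ∀ {m} (xs : Fin m → B) x → (xs ∷ʳ x) (fromℕ m) ≡ x
  ∷ʳ-last {m} xs x rewrite view-fromℕ m = refl

  ∷ʳ-all : ∀ {p m} (P : B → Set p) {xs : Fin m → B} {x} →
           (∀ k → P (xs k)) → P x → ∀ i → P ((xs ∷ʳ x) i)
  ∷ʳ-all P {xs} {x} Pxs Px i with view i
  ... | ‵fromℕ = Px
  ... | ‵inj₁ {i = k} _ = Pxs k

open FinSnoc

module JAlgebraProperties {a} (𝔄 : JAlgebra a) where

  open JAlgebra 𝔄

  infix 4 _≤_

  _≤_ : A → A → Set a
  _≤_ = Defs._≤_ 𝔄

  ≤-refl : ∀ {x} → x ≤ x
  ≤-refl {x} = ·-idem x

  ≤-reflexive : ∀ {x y} → x ≡ y → x ≤ y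
  ≤-reflexive refl = ≤-refl

  ≤-trans : ∀ {x y z} → x ≤ y → y ≤ z → x ≤ z
  ≤-trans {x} {y} {z} x≤y y≤z = begin
    x · z        ≡⟨ cong (_· z) (sym x≤y) ⟩
    x · y · z    ≡⟨ sym (·-assoc x y z) ⟩
    x · (y · z)  ≡⟨ cong (x ·_) y≤z ⟩
    x · y        ≡⟨ x≤y ⟩
    x            ∎
    where open ≡-Reasoning

  ≤-antisym : ∀ {x y} → x ≤ y → y ≤ x → x ≡ y
  ≤-antisym {x} {y} x≤y y≤x = trans (sym x≤y) (trans (·-comm x y) y≤x)

  ≤-isPartialOrder : IsPartialOrder _≡_ _≤_
  ≤-isPartialOrder = record
    { isPreorder = record
      { isEquivalence = isEquivalence
      ; reflexive     = ≤-reflexive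
      ; trans         = ≤-trans
      }
    ; antisym = ≤-antisym
    }

  ≤-poset : Poset a a a
  ≤-poset = record { isPartialOrder = ≤-isPartialOrder }

  open PartialOrderReasoning ≤-poset public

  x·y≤x : ∀ {x y} → x · y ≤ x
  x·y≤x {x} {y} = begin-equality
    x · y · x    ≡⟨ ·-assoc x y x ⟨
    x · (y · x)  ≡⟨ cong (x ·_) (·-comm y x) ⟩
    x · (x · y)  ≡⟨ ·-assoc x x y ⟩
    x · x · y    ≡⟨ cong (_· y) (·-idem x) ⟩
    x · y        ∎

  x·y≤y : ∀ {x y} → x · y ≤ y
  x·y≤y {x} {y} = trans (sym (·-assoc x y y)) (cong (x ·_) (·-idem y))

  ·-glb : ∀ {x y z} → z ≤ x → z ≤ y → z ≤ x · y
  ·-glb {x} {y} {z} z≤x z≤y = trans (·-assoc z x y) (trans (cong (_· y) z≤x) z≤y)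

  ·-monoʳ-≤ : ∀ {x y z} → x ≤ y → z · x ≤ z · y
  ·-monoʳ-≤ x≤y = ·-glb x·y≤x (≤-trans x·y≤y x≤y)

  x≤𝟙 : ∀ {x} → x ≤ 𝟙
  x≤𝟙 {x} = 𝟙-· x

  x≤𝟘⇒x≡𝟘 : ∀ {x} → x ≤ 𝟘 → x ≡ 𝟘
  x≤𝟘⇒x≡𝟘 {x} x≤𝟘 = trans (sym x≤𝟘) (trans (·-comm x 𝟘) (𝟘-· x))

  ˘-mono-≤ : ∀ {x y} → x ≤ y → x ˘ ≤ y ˘
  ˘-mono-≤ {x} {y} x≤y = trans (sym (˘-· x y)) (cong _˘ x≤y)

  ˘-cancel-≤ : ∀ {x y} → x ˘ ≤ y ˘ → x ≤ y
  ˘-cancel-≤ {x} {y} x˘≤y˘ = subst₂ _≤_ (˘-invol x) (˘-invol y) (˘-mono-≤ x˘≤y˘)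

  1'˘≡1' : 1' ˘ ≡ 1'
  1'˘≡1' = begin-equality
    1' ˘               ≡⟨ ⨾-identʳ (1' ˘) ⟨
    1' ˘ ⨾ 1'          ≡⟨ cong (1' ˘ ⨾_) (˘-invol 1') ⟨
    1' ˘ ⨾ 1' ˘ ˘      ≡⟨ ˘-⨾ (1' ˘) 1' ⟨
    (1' ˘ ⨾ 1') ˘      ≡⟨ cong _˘ (⨾-identʳ (1' ˘)) ⟩
    1' ˘ ˘             ≡⟨ ˘-invol 1' ⟩
    1'                 ∎

  𝟘˘≡𝟘 : 𝟘 ˘ ≡ 𝟘
  𝟘˘≡𝟘 = x≤𝟘⇒x≡𝟘 (subst (𝟘 ˘ ≤_) (˘-invol 𝟘) (˘-mono-≤ (𝟘-· (𝟘 ˘))))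

  ⨾-identityˡ : ∀ x → 1' ⨾ x ≡ x
  ⨾-identityˡ x = begin-equality
    1' ⨾ x             ≡⟨ cong₂ _⨾_ 1'˘≡1' (˘-invol x) ⟨
    1' ˘ ⨾ x ˘ ˘       ≡⟨ ˘-⨾ (x ˘) 1' ⟨
    (x ˘ ⨾ 1') ˘       ≡⟨ cong _˘ (⨾-identʳ (x ˘)) ⟩
    x ˘ ˘              ≡⟨ ˘-invol x ⟩
    x                  ∎

  ⨾-zeroˡ : ∀ x → 𝟘 ⨾ x ≡ 𝟘
  ⨾-zeroˡ x = begin-equality
    𝟘 ⨾ x              ≡⟨ cong₂ _⨾_ 𝟘˘≡𝟘 (˘-invol x) ⟨
    𝟘 ˘ ⨾ x ˘ ˘        ≡⟨ ˘-⨾ (x ˘) 𝟘 ⟨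
    (x ˘ ⨾ 𝟘) ˘        ≡⟨ cong _˘ (⨾-𝟘 (x ˘)) ⟩
    𝟘 ˘                ≡⟨ 𝟘˘≡𝟘 ⟩
    𝟘                  ∎

  ⨾-monoˡ-≤ : ∀ {x y z} → x ≤ y → x ⨾ z ≤ y ⨾ z
  ⨾-monoˡ-≤ {x} {y} {z} x≤y =
    subst (λ u → u ⨾ z · y ⨾ z ≡ u ⨾ z) x≤y (sym (⨾-semidist x y z))

  ⨾-monoʳ-≤ : ∀ {x y z} → x ≤ y → z ⨾ x ≤ z ⨾ y
  ⨾-monoʳ-≤ {x} {y} {z} x≤y = ˘-cancel-≤ (begin
    (z ⨾ x) ˘    ≡⟨ ˘-⨾ z x ⟩
    x ˘ ⨾ z ˘    ≤⟨ ⨾-monoˡ-≤ (˘-mono-≤ x≤y) ⟩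
    y ˘ ⨾ z ˘    ≡⟨ ˘-⨾ z y ⟨
    (z ⨾ y) ˘    ∎)

  x≤x⨾𝟙 : ∀ {x} → x ≤ x ⨾ 𝟙
  x≤x⨾𝟙 {x} = begin
    x       ≡⟨ ⨾-identʳ x ⟨
    x ⨾ 1'  ≤⟨ ⨾-monoʳ-≤ x≤𝟙 ⟩
    x ⨾ 𝟙   ∎

  ⨾-mono-≤ : ∀ {x y u v} → x ≤ y → u ≤ v → x ⨾ u ≤ y ⨾ v
  ⨾-mono-≤ x≤y u≤v = ≤-trans (⨾-monoˡ-≤ x≤y) (⨾-monoʳ-≤ u≤v)

  modularʳ : ∀ x y z → x ⨾ y · z ≤ x ⨾ (y · x ˘ ⨾ z)
  modularʳ x y z = begin
    x ⨾ y · z                                 ≡⟨ modular x y z ⟩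
    (z ⨾ y ˘ · x) ⨾ (y · x ˘ ⨾ z) · z         ≤⟨ x·y≤x ⟩
    (z ⨾ y ˘ · x) ⨾ (y · x ˘ ⨾ z)             ≤⟨ ⨾-monoˡ-≤ x·y≤y ⟩
    x ⨾ (y · x ˘ ⨾ z)                         ∎

  modularˡ : ∀ x y z → x ⨾ y · z ≤ (z ⨾ y ˘ · x) ⨾ y
  modularˡ x y z = begin
    x ⨾ y · z                                 ≡⟨ modular x y z ⟩
    (z ⨾ y ˘ · x) ⨾ (y · x ˘ ⨾ z) · z         ≤⟨ x·y≤x ⟩
    (z ⨾ y ˘ · x) ⨾ (y · x ˘ ⨾ z)             ≤⟨ ⨾-monoʳ-≤ x·y≤x ⟩
    (z ⨾ y ˘ · x) ⨾ y                         ∎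

  1'·x⨾y≤y˘⨾y : ∀ x y → 1' · x ⨾ y ≤ y ˘ ⨾ y
  1'·x⨾y≤y˘⨾y x y = begin
    1' · x ⨾ y              ≡⟨ ·-comm 1' (x ⨾ y) ⟩
    x ⨾ y · 1'              ≤⟨ modularˡ x y 1' ⟩
    (1' ⨾ y ˘ · x) ⨾ y      ≤⟨ ⨾-monoˡ-≤ x·y≤x ⟩
    1' ⨾ y ˘ ⨾ y            ≡⟨ cong (_⨾ y) (⨾-identityˡ (y ˘)) ⟩
    y ˘ ⨾ y                 ∎

  ≢𝟘-≤⨾⇒⨾˘·≢𝟘 : ∀ {a b c} → ¬ (c ≡ 𝟘) → c ≤ a ⨾ b → ¬ (c ⨾ b ˘ · a ≡ 𝟘)
  ≢𝟘-≤⨾⇒⨾˘·≢𝟘 {a} {b} {c} c≢𝟘 c≤a⨾b c⨾b˘·a≡𝟘 = c≢𝟘 (x≤𝟘⇒x≡𝟘 (begin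
    c                 ≤⟨ ·-glb c≤a⨾b ≤-refl ⟩
    a ⨾ b · c         ≤⟨ modularˡ a b c ⟩
    (c ⨾ b ˘ · a) ⨾ b ≡⟨ cong (_⨾ b) c⨾b˘·a≡𝟘 ⟩
    𝟘 ⨾ b             ≡⟨ ⨾-zeroˡ b ⟩
    𝟘                 ∎))

  ≤1'⇒˘≤1' : ∀ {δ} → δ ≤ 1' → δ ˘ ≤ 1'
  ≤1'⇒˘≤1' δ≤1' = subst (_ ≤_) 1'˘≡1' (˘-mono-≤ δ≤1')

  ≤1'⇒≤⨾ : ∀ {δ c} → δ ≤ 1' → δ ≤ c → δ ≤ δ ⨾ c
  ≤1'⇒≤⨾ {δ} {c} δ≤1' δ≤c = begin
    δ                  ≤⟨ ·-glb (≤-reflexive (sym (⨾-identʳ δ))) δ≤c ⟩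
    δ ⨾ 1' · c         ≤⟨ modularʳ δ 1' c ⟩
    δ ⨾ (1' · δ ˘ ⨾ c) ≤⟨ ⨾-monoʳ-≤ x·y≤y ⟩
    δ ⨾ (δ ˘ ⨾ c)      ≤⟨ ⨾-monoʳ-≤ (⨾-monoˡ-≤ (≤1'⇒˘≤1' δ≤1')) ⟩
    δ ⨾ (1' ⨾ c)       ≡⟨ cong (δ ⨾_) (⨾-identityˡ c) ⟩
    δ ⨾ c              ∎

  ≤1'-restrict-⨾𝟙 : ∀ {δ c} → δ ≤ 1' → δ ≤ c ⨾ 𝟙 → δ ⨾ c ⨾ 𝟙 ≡ δ ⨾ 𝟙
  ≤1'-restrict-⨾𝟙 {δ} {c} δ≤1' δ≤c⨾𝟙 = ≤-antisym
    (begin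
      δ ⨾ c ⨾ 𝟙        ≡⟨ ⨾-assoc δ c 𝟙 ⟨
      δ ⨾ (c ⨾ 𝟙)      ≤⟨ ⨾-monoʳ-≤ x≤𝟙 ⟩
      δ ⨾ 𝟙            ∎)
    (begin
      δ ⨾ 𝟙            ≤⟨ ⨾-monoˡ-≤ (≤1'⇒≤⨾ δ≤1' δ≤c⨾𝟙) ⟩
      δ ⨾ (c ⨾ 𝟙) ⨾ 𝟙  ≡⟨ ⨾-assoc δ (c ⨾ 𝟙) 𝟙 ⟨
      δ ⨾ (c ⨾ 𝟙 ⨾ 𝟙)  ≡⟨ cong (δ ⨾_) (⨾-assoc c 𝟙 𝟙) ⟨
      δ ⨾ (c ⨾ (𝟙 ⨾ 𝟙)) ≤⟨ ⨾-monoʳ-≤ (⨾-monoʳ-≤ x≤𝟙) ⟩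
      δ ⨾ (c ⨾ 𝟙)      ≡⟨ ⨾-assoc δ c 𝟙 ⟩
      δ ⨾ c ⨾ 𝟙        ∎)

  ≤1'⇒Functional : ∀ {δ} → δ ≤ 1' → Functional 𝔄 δ
  ≤1'⇒Functional {δ} δ≤1' = begin
    δ ˘ ⨾ δ    ≤⟨ ⨾-mono-≤ (≤1'⇒˘≤1' δ≤1') δ≤1' ⟩
    1' ⨾ 1'    ≡⟨ ⨾-identʳ 1' ⟩
    1'         ∎

  Functional-⨾ : ∀ {x y} → Functional 𝔄 x → Functional 𝔄 y → Functional 𝔄 (x ⨾ y)
  Functional-⨾ {x} {y} x-fun y-fun = begin
    (x ⨾ y) ˘ ⨾ (x ⨾ y)   ≡⟨ cong (_⨾ (x ⨾ y)) (˘-⨾ x y) ⟩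
    y ˘ ⨾ x ˘ ⨾ (x ⨾ y)   ≡⟨ ⨾-assoc (y ˘ ⨾ x ˘) x y ⟩
    y ˘ ⨾ x ˘ ⨾ x ⨾ y     ≡⟨ cong (_⨾ y) (⨾-assoc (y ˘) (x ˘) x) ⟨
    y ˘ ⨾ (x ˘ ⨾ x) ⨾ y   ≤⟨ ⨾-monoˡ-≤ (⨾-monoʳ-≤ x-fun) ⟩
    y ˘ ⨾ 1' ⨾ y          ≡⟨ cong (_⨾ y) (⨾-identʳ (y ˘)) ⟩
    y ˘ ⨾ y               ≤⟨ y-fun ⟩
    1'                    ∎

  Functional⇒⨾-distribˡ-· : ∀ {h} → Functional 𝔄 h → ∀ u v → h ⨾ u · h ⨾ v ≤ h ⨾ (u · v)
  Functional⇒⨾-distribˡ-· {h} h-fun u v = begin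
    h ⨾ u · h ⨾ v               ≤⟨ modularʳ h u (h ⨾ v) ⟩
    h ⨾ (u · h ˘ ⨾ (h ⨾ v))     ≤⟨ ⨾-monoʳ-≤ (·-monoʳ-≤ h˘⨾h⨾v≤v) ⟩
    h ⨾ (u · v)                 ∎
    where
    h˘⨾h⨾v≤v : h ˘ ⨾ (h ⨾ v) ≤ v
    h˘⨾h⨾v≤v = begin
      h ˘ ⨾ (h ⨾ v)   ≡⟨ ⨾-assoc (h ˘) h v ⟩
      h ˘ ⨾ h ⨾ v     ≤⟨ ⨾-monoˡ-≤ h-fun ⟩
      1' ⨾ v          ≡⟨ ⨾-identityˡ v ⟩
      v               ∎

  record Tabulation (w : A) : Set a where
    field
      p q          : A
      p-functional : Functional 𝔄 p
      q-functional : Functional 𝔄 q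
      p˘⨾q≢𝟘       : ¬ (p ˘ ⨾ q ≡ 𝟘)
      p˘⨾q≤w       : p ˘ ⨾ q ≤ w

  tabulate : Tabular 𝔄 → ∀ {w} → ¬ (w ≡ 𝟘) → Tabulation w
  tabulate tab {w} w≢𝟘 with tab 𝟘 w (𝟘-· w , w≢𝟘)
  ... | p , q , p-fun , q-fun , p˘⨾q≢𝟘 , p˘⨾q≤w , _ =
    record { p = p ; q = q ; p-functional = p-fun ; q-functional = q-fun
           ; p˘⨾q≢𝟘 = p˘⨾q≢𝟘 ; p˘⨾q≤w = p˘⨾q≤w }

module Extension {a} (𝔄 : JAlgebra a) {m : ℕ} (f : Fin m → JAlgebra.A 𝔄)
                 (p q : JAlgebra.A 𝔄) where

  open JAlgebra 𝔄
  open JAlgebraProperties 𝔄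

  δ : A
  δ = 1' · p ⨾ (p ˘ ⨾ q ⨾ q ˘)

  g : Fin (suc m) → A
  g = (λ k → δ ⨾ p ⨾ f k) ∷ʳ δ ⨾ q

  g-inject₁ : ∀ k → g (inject₁ k) ≡ δ ⨾ p ⨾ f k
  g-inject₁ = ∷ʳ-inject₁ (λ k → δ ⨾ p ⨾ f k) (δ ⨾ q)

  g-last : g (fromℕ m) ≡ δ ⨾ q
  g-last = ∷ʳ-last (λ k → δ ⨾ p ⨾ f k) (δ ⨾ q)

  δ≤1' : δ ≤ 1'
  δ≤1' = x·y≤x

  δ≤q⨾q˘ : δ ≤ q ⨾ q ˘
  δ≤q⨾q˘ = begin
    1' · p ⨾ (p ˘ ⨾ q ⨾ q ˘)   ≡⟨ cong (1' ·_) (⨾-assoc p (p ˘ ⨾ q) (q ˘)) ⟩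
    1' · p ⨾ (p ˘ ⨾ q) ⨾ q ˘   ≤⟨ 1'·x⨾y≤y˘⨾y (p ⨾ (p ˘ ⨾ q)) (q ˘) ⟩
    q ˘ ˘ ⨾ q ˘                ≡⟨ cong (_⨾ q ˘) (˘-invol q) ⟩
    q ⨾ q ˘                    ∎

  δ≤p⨾c⨾𝟙 : ∀ {c} → p ˘ ⨾ q ≤ c ⨾ 𝟙 → δ ≤ p ⨾ c ⨾ 𝟙
  δ≤p⨾c⨾𝟙 {c} p˘⨾q≤c⨾𝟙 = begin
    δ                       ≤⟨ x·y≤y ⟩
    p ⨾ (p ˘ ⨾ q ⨾ q ˘)     ≤⟨ ⨾-monoʳ-≤ (⨾-monoˡ-≤ p˘⨾q≤c⨾𝟙) ⟩
    p ⨾ (c ⨾ 𝟙 ⨾ q ˘)       ≡⟨ cong (p ⨾_) (⨾-assoc c 𝟙 (q ˘)) ⟨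
    p ⨾ (c ⨾ (𝟙 ⨾ q ˘))     ≤⟨ ⨾-monoʳ-≤ (⨾-monoʳ-≤ x≤𝟙) ⟩
    p ⨾ (c ⨾ 𝟙)             ≡⟨ ⨾-assoc p c 𝟙 ⟩
    p ⨾ c ⨾ 𝟙               ∎

  p˘⨾q≤p˘⨾δ⨾q : p ˘ ⨾ q ≤ p ˘ ⨾ δ ⨾ q
  p˘⨾q≤p˘⨾δ⨾q = begin
    p ˘ ⨾ q                                    ≤⟨ ·-glb ≤-refl ≤-refl ⟩
    p ˘ ⨾ q · p ˘ ⨾ q                          ≤⟨ modularˡ (p ˘) q (p ˘ ⨾ q) ⟩
    (p ˘ ⨾ q ⨾ q ˘ · p ˘) ⨾ q                  ≡⟨ cong (_⨾ q) (·-comm (p ˘ ⨾ q ⨾ q ˘) (p ˘)) ⟩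
    (p ˘ · p ˘ ⨾ q ⨾ q ˘) ⨾ q                  ≡⟨ cong (λ u → (u · p ˘ ⨾ q ⨾ q ˘) ⨾ q) (⨾-identʳ (p ˘)) ⟨
    (p ˘ ⨾ 1' · p ˘ ⨾ q ⨾ q ˘) ⨾ q             ≤⟨ ⨾-monoˡ-≤ (modularʳ (p ˘) 1' (p ˘ ⨾ q ⨾ q ˘)) ⟩
    p ˘ ⨾ (1' · p ˘ ˘ ⨾ (p ˘ ⨾ q ⨾ q ˘)) ⨾ q   ≡⟨ cong (λ u → p ˘ ⨾ (1' · u ⨾ (p ˘ ⨾ q ⨾ q ˘)) ⨾ q) (˘-invol p) ⟩
    p ˘ ⨾ δ ⨾ q                                ∎

  δ≢𝟘 : ¬ (p ˘ ⨾ q ≡ 𝟘) → ¬ (δ ≡ 𝟘)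
  δ≢𝟘 p˘⨾q≢𝟘 δ≡𝟘 = p˘⨾q≢𝟘 (x≤𝟘⇒x≡𝟘 (begin
    p ˘ ⨾ q       ≤⟨ p˘⨾q≤p˘⨾δ⨾q ⟩
    p ˘ ⨾ δ ⨾ q   ≡⟨ cong (λ u → p ˘ ⨾ u ⨾ q) δ≡𝟘 ⟩
    p ˘ ⨾ 𝟘 ⨾ q   ≡⟨ cong (_⨾ q) (⨾-𝟘 (p ˘)) ⟩
    𝟘 ⨾ q         ≡⟨ ⨾-zeroˡ q ⟩
    𝟘             ∎))

  g-preserves-Hat : ∀ {z k l} → Hat 𝔄 f z k l → Hat 𝔄 g z (inject₁ k) (inject₁ l)
  g-preserves-Hat {z} {k} {l} fl≤fk⨾z = begin
    g (inject₁ l)        ≡⟨ g-inject₁ l ⟩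
    δ ⨾ p ⨾ f l          ≤⟨ ⨾-monoʳ-≤ fl≤fk⨾z ⟩
    δ ⨾ p ⨾ (f k ⨾ z)    ≡⟨ ⨾-assoc (δ ⨾ p) (f k) z ⟩
    δ ⨾ p ⨾ f k ⨾ z      ≡⟨ cong (_⨾ z) (g-inject₁ k) ⟨
    g (inject₁ k) ⨾ z    ∎

  g-preserves-disjoint : Functional 𝔄 p → ∀ {k l z} → f k ⨾ z · f l ≡ 𝟘 →
                         g (inject₁ k) ⨾ z · g (inject₁ l) ≡ 𝟘
  g-preserves-disjoint p-fun {k} {l} {z} fk⨾z·fl≡𝟘 = x≤𝟘⇒x≡𝟘 (begin
    g (inject₁ k) ⨾ z · g (inject₁ l)   ≡⟨ cong₂ (λ u v → u ⨾ z · v) (g-inject₁ k) (g-inject₁ l) ⟩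
    δ ⨾ p ⨾ f k ⨾ z · δ ⨾ p ⨾ f l       ≡⟨ cong (_· δ ⨾ p ⨾ f l) (⨾-assoc (δ ⨾ p) (f k) z) ⟨
    δ ⨾ p ⨾ (f k ⨾ z) · δ ⨾ p ⨾ f l     ≤⟨ Functional⇒⨾-distribˡ-· δ⨾p-fun (f k ⨾ z) (f l) ⟩
    δ ⨾ p ⨾ (f k ⨾ z · f l)             ≡⟨ cong (δ ⨾ p ⨾_) fk⨾z·fl≡𝟘 ⟩
    δ ⨾ p ⨾ 𝟘                           ≡⟨ ⨾-𝟘 (δ ⨾ p) ⟩
    𝟘                                   ∎)
    where
    δ⨾p-fun : Functional 𝔄 (δ ⨾ p)
    δ⨾p-fun = Functional-⨾ (≤1'⇒Functional δ≤1') p-fun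

  g-Hat-last : Functional 𝔄 q → ∀ {i x} → p ˘ ⨾ q ≤ f i ⨾ x → Hat 𝔄 g x (inject₁ i) (fromℕ m)
  g-Hat-last q-fun {i} {x} p˘⨾q≤fi⨾x = begin
    g (fromℕ m)                       ≡⟨ g-last ⟩
    δ ⨾ q                             ≤⟨ ⨾-monoˡ-≤ (≤1'⇒≤⨾ δ≤1' x·y≤y) ⟩
    δ ⨾ (p ⨾ (p ˘ ⨾ q ⨾ q ˘)) ⨾ q     ≡⟨ cong (_⨾ q) (⨾-assoc δ p _) ⟩
    δ ⨾ p ⨾ (p ˘ ⨾ q ⨾ q ˘) ⨾ q       ≡⟨ ⨾-assoc (δ ⨾ p) _ q ⟨
    δ ⨾ p ⨾ (p ˘ ⨾ q ⨾ q ˘ ⨾ q)       ≡⟨ cong (δ ⨾ p ⨾_) (⨾-assoc (p ˘ ⨾ q) (q ˘) q) ⟨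
    δ ⨾ p ⨾ (p ˘ ⨾ q ⨾ (q ˘ ⨾ q))     ≤⟨ ⨾-monoʳ-≤ (⨾-monoʳ-≤ q-fun) ⟩
    δ ⨾ p ⨾ (p ˘ ⨾ q ⨾ 1')            ≡⟨ cong (δ ⨾ p ⨾_) (⨾-identʳ (p ˘ ⨾ q)) ⟩
    δ ⨾ p ⨾ (p ˘ ⨾ q)                 ≤⟨ ⨾-monoʳ-≤ p˘⨾q≤fi⨾x ⟩
    δ ⨾ p ⨾ (f i ⨾ x)                 ≡⟨ ⨾-assoc (δ ⨾ p) (f i) x ⟩
    δ ⨾ p ⨾ f i ⨾ x                   ≡⟨ cong (_⨾ x) (g-inject₁ i) ⟨
    g (inject₁ i) ⨾ x                 ∎

  g-last-Hat : ∀ {j} → Functional 𝔄 (f j) → ∀ {y} → p ˘ ⨾ q ≤ f j ⨾ y ˘ →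
               Hat 𝔄 g y (fromℕ m) (inject₁ j)
  g-last-Hat {j} fj-fun {y} p˘⨾q≤fj⨾y˘ = begin
    g (inject₁ j)                 ≡⟨ g-inject₁ j ⟩
    δ ⨾ p ⨾ f j                   ≤⟨ ⨾-monoˡ-≤ (⨾-monoˡ-≤ (≤1'⇒≤⨾ δ≤1' δ≤q⨾q˘)) ⟩
    δ ⨾ (q ⨾ q ˘) ⨾ p ⨾ f j       ≡⟨ cong (λ u → u ⨾ p ⨾ f j) (⨾-assoc δ q (q ˘)) ⟩
    δ ⨾ q ⨾ q ˘ ⨾ p ⨾ f j         ≡⟨ cong (_⨾ f j) (⨾-assoc (δ ⨾ q) (q ˘) p) ⟨
    δ ⨾ q ⨾ (q ˘ ⨾ p) ⨾ f j       ≡⟨ ⨾-assoc (δ ⨾ q) (q ˘ ⨾ p) (f j) ⟨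
    δ ⨾ q ⨾ (q ˘ ⨾ p ⨾ f j)       ≤⟨ ⨾-monoʳ-≤ (⨾-monoˡ-≤ q˘⨾p≤y⨾fj˘) ⟩
    δ ⨾ q ⨾ (y ⨾ f j ˘ ⨾ f j)     ≡⟨ cong (δ ⨾ q ⨾_) (⨾-assoc y (f j ˘) (f j)) ⟨
    δ ⨾ q ⨾ (y ⨾ (f j ˘ ⨾ f j))   ≤⟨ ⨾-monoʳ-≤ (⨾-monoʳ-≤ fj-fun) ⟩
    δ ⨾ q ⨾ (y ⨾ 1')              ≡⟨ cong (δ ⨾ q ⨾_) (⨾-identʳ y) ⟩
    δ ⨾ q ⨾ y                     ≡⟨ cong (_⨾ y) g-last ⟨
    g (fromℕ m) ⨾ y               ∎
    where
    q˘⨾p≤y⨾fj˘ : q ˘ ⨾ p ≤ y ⨾ f j ˘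
    q˘⨾p≤y⨾fj˘ = begin
      q ˘ ⨾ p            ≡⟨ cong (q ˘ ⨾_) (˘-invol p) ⟨
      q ˘ ⨾ p ˘ ˘        ≡⟨ ˘-⨾ (p ˘) q ⟨
      (p ˘ ⨾ q) ˘        ≤⟨ ˘-mono-≤ p˘⨾q≤fj⨾y˘ ⟩
      (f j ⨾ y ˘) ˘      ≡⟨ ˘-⨾ (f j) (y ˘) ⟩
      y ˘ ˘ ⨾ f j ˘      ≡⟨ cong (_⨾ f j ˘) (˘-invol y) ⟩
      y ⨾ f j ˘          ∎

  g-∈S : Functional 𝔄 p → Functional 𝔄 q → ¬ (p ˘ ⨾ q ≡ 𝟘) →
         (∀ k → Functional 𝔄 (f k)) → (∀ k l → f k ⨾ 𝟙 ≡ f l ⨾ 𝟙) →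
         ∀ {i} → p ˘ ⨾ q ≤ f i ⨾ 𝟙 → InS 𝔄 (suc m) g
  g-∈S p-fun q-fun p˘⨾q≢𝟘 f-fun f-dom {i} p˘⨾q≤fi⨾𝟙 =
    g-nonzero , ∷ʳ-all (Functional 𝔄) (λ k → Functional-⨾ δ⨾p-fun (f-fun k)) δ⨾q-fun ,
    λ k l → trans (g-dom k) (sym (g-dom l))
    where
    δ-fun : Functional 𝔄 δ
    δ-fun = ≤1'⇒Functional δ≤1'

    δ⨾p-fun : Functional 𝔄 (δ ⨾ p)
    δ⨾p-fun = Functional-⨾ δ-fun p-fun

    δ⨾q-fun : Functional 𝔄 (δ ⨾ q)
    δ⨾q-fun = Functional-⨾ δ-fun q-fun

    δ⨾p⨾fk⨾𝟙≡δ⨾𝟙 : ∀ k → δ ⨾ p ⨾ f k ⨾ 𝟙 ≡ δ ⨾ 𝟙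
    δ⨾p⨾fk⨾𝟙≡δ⨾𝟙 k = begin-equality
      δ ⨾ p ⨾ f k ⨾ 𝟙     ≡⟨ ⨾-assoc (δ ⨾ p) (f k) 𝟙 ⟨
      δ ⨾ p ⨾ (f k ⨾ 𝟙)   ≡⟨ cong (δ ⨾ p ⨾_) (f-dom k i) ⟩
      δ ⨾ p ⨾ (f i ⨾ 𝟙)   ≡⟨ ⨾-assoc (δ ⨾ p) (f i) 𝟙 ⟩
      δ ⨾ p ⨾ f i ⨾ 𝟙     ≡⟨ cong (_⨾ 𝟙) (⨾-assoc δ p (f i)) ⟨
      δ ⨾ (p ⨾ f i) ⨾ 𝟙   ≡⟨ ≤1'-restrict-⨾𝟙 δ≤1' (δ≤p⨾c⨾𝟙 p˘⨾q≤fi⨾𝟙) ⟩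
      δ ⨾ 𝟙               ∎

    δ⨾q⨾𝟙≡δ⨾𝟙 : δ ⨾ q ⨾ 𝟙 ≡ δ ⨾ 𝟙
    δ⨾q⨾𝟙≡δ⨾𝟙 = ≤1'-restrict-⨾𝟙 δ≤1' (≤-trans δ≤q⨾q˘ (⨾-monoʳ-≤ x≤𝟙))

    g-dom : ∀ k → g k ⨾ 𝟙 ≡ δ ⨾ 𝟙
    g-dom = ∷ʳ-all (λ u → u ⨾ 𝟙 ≡ δ ⨾ 𝟙) δ⨾p⨾fk⨾𝟙≡δ⨾𝟙 δ⨾q⨾𝟙≡δ⨾𝟙

    g-nonzero : ∀ k → ¬ (g k ≡ 𝟘)
    g-nonzero k gk≡𝟘 = δ≢𝟘 p˘⨾q≢𝟘 (x≤𝟘⇒x≡𝟘 (begin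
      δ          ≤⟨ x≤x⨾𝟙 ⟩
      δ ⨾ 𝟙      ≡⟨ g-dom k ⟨
      g k ⨾ 𝟙    ≡⟨ cong (_⨾ 𝟙) gk≡𝟘 ⟩
      𝟘 ⨾ 𝟙      ≡⟨ ⨾-zeroˡ 𝟙 ⟩
      𝟘          ∎))

lemma81 : ∀ {a : Level} (𝔄 : JAlgebra a) → Tabular 𝔄 →
    let open JAlgebra 𝔄 in
    (m : ℕ) (i j : Fin m) (f : Fin m → A) → InS 𝔄 m f → (x y : A) →
    Hat 𝔄 f (x ⨾ y) i j →
    Σ (Fin (suc m) → A) λ g → InS 𝔄 (suc m) g
      × Comp 𝔄 (Hat 𝔄 g x) (Hat 𝔄 g y) (inject₁ i) (inject₁ j)
      × (∀ (z : A) (k l : Fin m) → Hat 𝔄 f z k l →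
           Hat 𝔄 g z (inject₁ k) (inject₁ l))
      × (∀ (k l : Fin m) (z : A) → f k ⨾ z · f l ≡ 𝟘 →
           g (inject₁ k) ⨾ z · g (inject₁ l) ≡ 𝟘)
lemma81 𝔄 tab m i j f (f≢𝟘 , f-fun , f-dom) x y fj≤fi⨾x⨾y =
  g , g-∈S p-functional q-functional p˘⨾q≢𝟘 f-fun f-dom p˘⨾q≤fi⨾𝟙 ,
  (fromℕ m , g-Hat-last q-functional p˘⨾q≤fi⨾x , g-last-Hat (f-fun j) p˘⨾q≤fj⨾y˘) ,
  (λ z k l → g-preserves-Hat) , (λ k l z → g-preserves-disjoint p-functional)
  where
  open JAlgebra 𝔄
  open JAlgebraProperties 𝔄

  w≢𝟘 : ¬ (f j ⨾ y ˘ · f i ⨾ x ≡ 𝟘)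
  w≢𝟘 = ≢𝟘-≤⨾⇒⨾˘·≢𝟘 (f≢𝟘 j) (subst (f j ≤_) (⨾-assoc (f i) x y) fj≤fi⨾x⨾y)

  open Tabulation (tabulate tab w≢𝟘)
  open Extension 𝔄 f p q

  p˘⨾q≤fi⨾x : p ˘ ⨾ q ≤ f i ⨾ x
  p˘⨾q≤fi⨾x = ≤-trans p˘⨾q≤w x·y≤y

  p˘⨾q≤fi⨾𝟙 : p ˘ ⨾ q ≤ f i ⨾ 𝟙
  p˘⨾q≤fi⨾𝟙 = ≤-trans p˘⨾q≤fi⨾x (⨾-monoʳ-≤ x≤𝟙)

  p˘⨾q≤fj⨾y˘ : p ˘ ⨾ q ≤ f j ⨾ y ˘
  p˘⨾q≤fj⨾y˘ = ≤-trans p˘⨾q≤w x·y≤x
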